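{- Let $G$ be an $\alpha$-weakly-Helly graph and $M\subseteq V(G)$. Let $y\in V(G)\setminus C_G^{\alpha}(M)$, let $x\in C_G^{\alpha}(M)$ be a vertex of $C_G^{\alpha}(M)$ closest to $y$, and let $P(y,x)$ be any shortest path from $y$ to $x$. Then $2\,\mathbb{U}(P(y,x))+\mathbb{H}(P(y,x))\le 2\alpha$.
   Context: All graphs are finite, simple, undirected, unweighted and connected. A graph $G$ is $\alpha$-weakly-Helly if for every family of pairwise intersecting disks $\{D_G(v,r(v)) : v\in S\}$ (where $D_G(v,r)=\{u: d_G(u,v)\le r\}$) the disks $D_G(v,r(v)+\alpha)$, $v\in S$, have a common vertex. $e_G^M(v)=\max_{u\in M}d_G(v,u)$, $rad_G(M)=\min_{v\in V(G)}e_G^M(v)$, $C_G^{\ell}(M)=\{v: e_G^M(v)\le rad_G(M)+\ell\}$. Traversing a path from $y$ towards $x$, a consecutive pair $(u,v)$ of adjacent vertices is an up-edge if $e_G^M(u)<e_G^M(v)$, a horizontal-edge if $e_G^M(u)=e_G^M(v)$, and a down-edge if $e_G^M(u)>e_G^M(v)$; $\mathbb{U}(P)$ and $\mathbb{H}(P)$ denote the numbers of up-edges and horizontal-edges along $P$. -}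

module Defs where

open import Data.Nat using (ℕ; zero; suc; _+_; _*_; _≤_; _<_; _<ᵇ_; _≡ᵇ_; _⊔_; _⊓_)
open import Data.Bool using (Bool; true; false; if_then_else_)
open import Data.Fin using (Fin)
open import Data.Fin.Subset using (Subset; _∈_)
open import Data.Vec using (lookup)
open import Data.List using (List; foldr; allFin)
open import Data.Product using (Σ; _×_; ∃; ∃-syntax)
open import Relation.Binary.PropositionalEquality using (_≡_; _≢_)

record Graph : Set where
  field
    n       : ℕ
    adj     : Fin n → Fin n → Bool
    adj-sym : ∀ u v → adj u v ≡ adj v u
    irrefl  : ∀ u → adj u u ≡ false

module _ (G : Graph) where
  open Graph G

  V : Set
  V = Fin n

  Edge : V → V → Set
  Edge u v = adj u v ≡ true

  data Walk : V → V → Set where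
    stop : (u : V) → Walk u u
    step : {u w v : V} → Edge u w → Walk w v → Walk u v

  len : {u v : V} → Walk u v → ℕ
  len (stop _)   = 0
  len (step _ p) = suc (len p)

  Connected : Set
  Connected = (0 < n) × (∀ (u v : V) → Walk u v)

  IsDistance : (V → V → ℕ) → Set
  IsDistance d = ∀ (u v : V) →
    (Σ (Walk u v) λ p → len p ≡ d u v) × (∀ (p : Walk u v) → d u v ≤ len p)

  module _ (d : V → V → ℕ) where

    InDisk : V → ℕ → V → Set
    InDisk v r z = d v z ≤ r

    WeaklyHelly : ℕ → Set
    WeaklyHelly α = ∀ (S : Subset n) (r : V → ℕ) →
      (∀ v w → v ∈ S → w ∈ S → ∃[ z ] (InDisk v (r v) z × InDisk w (r w) z)) →
      ∃[ z ] (∀ v → v ∈ S → InDisk v (r v + α) z)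

    module _ (M : Subset n) where

      -- e^M_G(v) = max_{u ∈ M} d(v,u)   (0 if M is empty)
      ecc : V → ℕ
      ecc v = foldr (λ u acc → if lookup M u then d v u ⊔ acc else acc) 0 (allFin n)

      -- rad_G(M) = min_{v ∈ V} e^M_G(v); the fold starts from the largest
      -- eccentricity, so for n > 0 this is exactly the minimum.
      rad : ℕ
      rad = foldr (λ v acc → ecc v ⊓ acc)
                  (foldr (λ v acc → ecc v ⊔ acc) 0 (allFin n)) (allFin n)

      InCenter : ℕ → V → Set
      InCenter ℓ v = ecc v ≤ rad + ℓ

      upCount : {u v : V} → Walk u v → ℕ
      upCount (stop _) = 0
      upCount (step {u} {w} _ p) = (if ecc u <ᵇ ecc w then 1 else 0) + upCount p

      horCount : {u v : V} → Walk u v → ℕ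
      horCount (stop _) = 0
      horCount (step {u} {w} _ p) = (if ecc u ≡ᵇ ecc w then 1 else 0) + horCount p

module Submission where

-- The proof combines two independent estimates.
--  * Counting.  Along any edge uw we have e(u) ≤ e(w) + 1, so an up-edge
--    raises e by at least 1, a horizontal edge keeps it, and a down-edge
--    lowers it by at most 1.  Summed along a walk p from u to v this gives
--    e(u) + 2·U(p) + H(p) ≤ e(v) + |p|   (walk-weight).
--  * Helly.  The disks D(v, R) for v ∈ M (R = rad(M)) together with
--    D(y, e(y) − R) pairwise intersect, so weak Helly yields a vertex z with
--    z ∈ C^α(M) and d(y,z) ≤ e(y) − R + α   (helly-centre).
-- As x is a closest centre vertex, |P| = d(y,x) ≤ e(y) − R + α, and e(x) ≤ R + α;
-- plugging both into the counting estimate gives the claim.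

open import Defs
open import Data.Nat using (ℕ; _+_; _*_; _≤_)
open import Data.Fin.Subset using (Subset)
open import Relation.Nullary using (¬_)
open import Relation.Binary.PropositionalEquality using (_≡_)

open import Data.Nat using (zero; suc; _<_; _∸_; _⊔_; _⊓_; _<ᵇ_; _≡ᵇ_; z≤n; s≤s)
open import Data.Nat.Properties hiding (_≟_)
open import Data.Nat.Tactic.RingSolver using (solve-∀)
open import Data.Bool using (Bool; true; false; if_then_else_)
open import Data.Fin using (fromℕ<)
open import Data.Fin.Properties using (_≟_)
open import Data.Fin.Subset using (_∪_; ⁅_⁆) renaming (_∈_ to _∈ₛ_)
open import Data.Fin.Subset.Properties using (x∈p∪q⁻; x∈p∪q⁺; x∈⁅x⁆; x∈⁅y⁆⇒x≡y)
open import Data.Vec using (lookup)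
open import Data.Vec.Properties using ([]=⇒lookup; lookup⇒[]=)
open import Data.List using (List; []; _∷_; foldr; allFin)
open import Data.List.Membership.Propositional using (_∈_)
open import Data.List.Membership.Propositional.Properties using (∈-allFin)
open import Data.List.Relation.Unary.Any using (here; there)
open import Data.Product using (Σ; _×_; _,_; proj₁; proj₂; ∃-syntax)
open import Data.Sum using (inj₁; inj₂)
open import Relation.Nullary using (yes; no)
open import Relation.Binary.PropositionalEquality using (refl; sym; trans; cong; cong₂; subst; _≢_)
open import Data.Empty using (⊥-elim)

module _ {A : Set} where

  foldr-⊔-upper : (g : A → ℕ) (l : List A) {a : A} → a ∈ l →
    g a ≤ foldr (λ v acc → g v ⊔ acc) 0 l
  foldr-⊔-upper g (v ∷ l) (here refl) = m≤m⊔n (g v) _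
  foldr-⊔-upper g (v ∷ l) (there a∈l) = m≤n⇒m≤o⊔n (g v) (foldr-⊔-upper g l a∈l)

  foldr-select-⊔-upper : (c : A → Bool) (g : A → ℕ) (l : List A) {a : A} →
    a ∈ l → c a ≡ true →
    g a ≤ foldr (λ v acc → if c v then g v ⊔ acc else acc) 0 l
  foldr-select-⊔-upper c g (v ∷ l) (here refl) ca rewrite ca = m≤m⊔n (g v) _
  foldr-select-⊔-upper c g (v ∷ l) (there a∈l) ca with c v
  ... | true  = m≤n⇒m≤o⊔n (g v) (foldr-select-⊔-upper c g l a∈l ca)
  ... | false = foldr-select-⊔-upper c g l a∈l ca

  foldr-select-⊔-least : (c : A → Bool) (g : A → ℕ) (l : List A) (k : ℕ) →
    (∀ a → a ∈ l → c a ≡ true → g a ≤ k) →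
    foldr (λ v acc → if c v then g v ⊔ acc else acc) 0 l ≤ k
  foldr-select-⊔-least c g []      k bound = z≤n
  foldr-select-⊔-least c g (v ∷ l) k bound with c v in cv
  ... | true  = ⊔-lub (bound v (here refl) cv)
                      (foldr-select-⊔-least c g l k (λ a a∈l → bound a (there a∈l)))
  ... | false = foldr-select-⊔-least c g l k (λ a a∈l → bound a (there a∈l))

  foldr-⊓-attained : (f : A → ℕ) (B : ℕ) (l : List A) →
    ∃[ a ] (f a ≤ B) → ∃[ a ] (f a ≤ foldr (λ v acc → f v ⊓ acc) B l)
  foldr-⊓-attained f B []      below = below
  foldr-⊓-attained f B (v ∷ l) below with ⊓-sel (f v) (foldr (λ v acc → f v ⊓ acc) B l)
  ... | inj₁ min≡fv = v , ≤-reflexive (sym min≡fv)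
  ... | inj₂ min≡rest with foldr-⊓-attained f B l below
  ...   | a , fa≤rest = a , ≤-trans fa≤rest (≤-reflexive (sym min≡rest))

module Walks (G : Graph) where
  open Graph G

  _++ʷ_ : {a b c : V G} → Walk G a b → Walk G b c → Walk G a c
  stop _   ++ʷ q = q
  step e p ++ʷ q = step e (p ++ʷ q)

  len-++ : {a b c : V G} (p : Walk G a b) (q : Walk G b c) →
    len G (p ++ʷ q) ≡ len G p + len G q
  len-++ (stop _)   q = refl
  len-++ (step e p) q = cong suc (len-++ p q)

  reverse-onto : {a b c : V G} → Walk G a b → Walk G a c → Walk G b c
  reverse-onto (stop _) acc = acc
  reverse-onto {a} (step {w = w} e p) acc = reverse-onto p (step (trans (adj-sym w a) e) acc)

  len-reverse-onto : {a b c : V G} (p : Walk G a b) (acc : Walk G a c) →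
    len G (reverse-onto p acc) ≡ len G p + len G acc
  len-reverse-onto (stop _)   acc = refl
  len-reverse-onto (step e p) acc = trans (len-reverse-onto p _) (+-suc (len G p) (len G acc))

  reverse : {a b : V G} → Walk G a b → Walk G b a
  reverse {a} p = reverse-onto p (stop a)

  len-reverse : {a b : V G} (p : Walk G a b) → len G (reverse p) ≡ len G p
  len-reverse p = trans (len-reverse-onto p _) (+-identityʳ (len G p))

  walk-split : {a b : V G} (p : Walk G a b) (j k : ℕ) → len G p ≤ j + k →
    ∃[ z ] (Σ (Walk G a z) λ q → Σ (Walk G z b) λ r → len G q ≤ j × len G r ≤ k)
  walk-split {a} p zero k p≤k = a , stop a , p , z≤n , p≤k
  walk-split {a} (stop _) (suc j) k _ = a , stop a , stop a , z≤n , z≤n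
  walk-split (step e p) (suc j) k (s≤s p≤j+k) with walk-split p j k p≤j+k
  ... | z , q , r , q≤j , r≤k = z , step e q , r , s≤s q≤j , r≤k

module Metric (G : Graph) (d : V G → V G → ℕ) (isD : IsDistance G d) where
  open Walks G

  geodesic : (u v : V G) → Σ (Walk G u v) λ p → len G p ≡ d u v
  geodesic u v = proj₁ (isD u v)

  d≤len : {u v : V G} (p : Walk G u v) → d u v ≤ len G p
  d≤len {u} {v} = proj₂ (isD u v)

  d-sym : (u v : V G) → d u v ≡ d v u
  d-sym u v = ≤-antisym (sym-≤ u v) (sym-≤ v u)
    where
    sym-≤ : (u v : V G) → d u v ≤ d v u
    sym-≤ u v with geodesic v u
    ... | p , |p|≡d = ≤-trans (d≤len (reverse p)) (≤-reflexive (trans (len-reverse p) |p|≡d))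

  d-triangle : (u v w : V G) → d u w ≤ d u v + d v w
  d-triangle u v w with geodesic u v | geodesic v w
  ... | p , |p|≡d | q , |q|≡d =
    ≤-trans (d≤len (p ++ʷ q)) (≤-reflexive (trans (len-++ p q) (cong₂ _+_ |p|≡d |q|≡d)))

  d-self : (u : V G) → d u u ≡ 0
  d-self u = n≤0⇒n≡0 (d≤len (stop u))

  d-edge : {u w : V G} → Edge G u w → d u w ≤ 1
  d-edge {u} {w} e = d≤len (step e (stop w))

  geodesic-split : (u w : V G) (j k : ℕ) → d u w ≤ j + k →
    ∃[ z ] (d u z ≤ j × d z w ≤ k)
  geodesic-split u w j k d≤j+k with geodesic u w
  ... | p , |p|≡d with walk-split p j k (≤-trans (≤-reflexive |p|≡d) d≤j+k)
  ...   | z , q , r , q≤j , r≤k = z , ≤-trans (d≤len q) q≤j , ≤-trans (d≤len r) r≤k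

up : ℕ → ℕ → ℕ
up a b = if a <ᵇ b then 1 else 0

horizontal : ℕ → ℕ → ℕ
horizontal a b = if a ≡ᵇ b then 1 else 0

-- if the value drops by at most 1 across an edge, twice an up-step plus a
-- horizontal step is paid for by the one unit of length of that edge
edge-weight : (a b : ℕ) → a ≤ suc b → a + (2 * up a b + horizontal a b) ≤ suc b
edge-weight zero          zero    _         = ≤-refl
edge-weight zero          (suc b) _         = s≤s (s≤s z≤n)
edge-weight (suc zero)    zero    _         = ≤-refl
edge-weight (suc (suc a)) zero    (s≤s ())
edge-weight (suc a)       (suc b) (s≤s a≤b) = s≤s (edge-weight a b a≤b)

module Eccentricity (G : Graph) (d : V G → V G → ℕ) (isD : IsDistance G d)
                    (M : Subset (Graph.n G)) where
  open Graph G
  open Metric G d isD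

  E : V G → ℕ
  E = ecc G d M

  R : ℕ
  R = rad G d M

  ecc-upper : (v u : V G) → u ∈ₛ M → d v u ≤ E v
  ecc-upper v u u∈M = foldr-select-⊔-upper (lookup M) (d v) (allFin n) (∈-allFin u) ([]=⇒lookup u∈M)

  ecc-least : (v : V G) (k : ℕ) → (∀ u → u ∈ₛ M → d v u ≤ k) → E v ≤ k
  ecc-least v k bound = foldr-select-⊔-least (lookup M) (d v) (allFin n) k
    (λ u _ Mu → bound u (lookup⇒[]= u M Mu))

  ecc-lipschitz : (u w : V G) → E u ≤ d u w + E w
  ecc-lipschitz u w = ecc-least u (d u w + E w) λ m m∈M →
    ≤-trans (d-triangle u w m) (+-monoʳ-≤ (d u w) (ecc-upper w m m∈M))

  ecc-edge : {u w : V G} → Edge G u w → E u ≤ suc (E w)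
  ecc-edge {u} {w} e = ≤-trans (ecc-lipschitz u w) (+-monoˡ-≤ (E w) (d-edge e))

  walk-weight : {u v : V G} (p : Walk G u v) →
    E u + (2 * upCount G d M p + horCount G d M p) ≤ E v + len G p
  walk-weight (stop _) = ≤-refl
  walk-weight {v = v} (step {u} {w} e p) = begin
      E u + (2 * (a + U) + (h + H))     ≡⟨ regroup (E u) a h U H ⟩
      (E u + (2 * a + h)) + (2 * U + H) ≤⟨ +-monoˡ-≤ (2 * U + H) (edge-weight (E u) (E w) (ecc-edge e)) ⟩
      suc (E w + (2 * U + H))           ≤⟨ s≤s (walk-weight p) ⟩
      suc (E v + len G p)               ≡⟨ sym (+-suc (E v) (len G p)) ⟩
      E v + suc (len G p)               ∎
    where
    open ≤-Reasoning
    a = up (E u) (E w)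
    h = horizontal (E u) (E w)
    U = upCount G d M p
    H = horCount G d M p
    regroup : ∀ x a h U H → x + (2 * (a + U) + (h + H)) ≡ (x + (2 * a + h)) + (2 * U + H)
    regroup = solve-∀

  centre-exists : 0 < n → ∃[ c ] (E c ≤ R)
  centre-exists pos = foldr-⊓-attained E _ (allFin n)
    (fromℕ< pos , foldr-⊔-upper E (allFin n) (∈-allFin (fromℕ< pos)))

  -- members of M have eccentricity at most 2R (through a centre c)
  ecc-member : 0 < n → (u : V G) → u ∈ₛ M → E u ≤ R + R
  ecc-member pos u u∈M with centre-exists pos
  ... | c , Ec≤R = begin
      E u         ≤⟨ ecc-lipschitz u c ⟩
      d u c + E c ≡⟨ cong (_+ E c) (d-sym u c) ⟩
      d c u + E c ≤⟨ +-mono-≤ (≤-trans (ecc-upper c u u∈M) Ec≤R) Ec≤R ⟩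
      R + R       ∎
    where open ≤-Reasoning

  module HellyFamily (pos : 0 < n) (y : V G) where

    S : Subset n
    S = M ∪ ⁅ y ⁆

    ρ : V G → ℕ
    ρ v with v ≟ y
    ... | yes _ = E y ∸ R
    ... | no _  = R

    ρ-y : ρ y ≡ E y ∸ R
    ρ-y with y ≟ y
    ... | yes _  = refl
    ... | no y≢y = ⊥-elim (y≢y refl)

    ρ-M : (v : V G) → v ≢ y → ρ v ≡ R
    ρ-M v v≢y with v ≟ y
    ... | yes v≡y = ⊥-elim (v≢y v≡y)
    ... | no _    = refl

    Meet : V G → V G → Set
    Meet v w = ∃[ z ] (InDisk G d v (ρ v) z × InDisk G d w (ρ w) z)

    meet-sym : {v w : V G} → Meet v w → Meet w v
    meet-sym (z , vz , wz) = z , wz , vz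

    data Kind (v : V G) : Set where
      is-y  : v ≡ y → Kind v
      in-M  : v ≢ y → v ∈ₛ M → Kind v

    kind : (v : V G) → v ∈ₛ S → Kind v
    kind v v∈S with v ≟ y | x∈p∪q⁻ M ⁅ y ⁆ v∈S
    ... | yes v≡y | _        = is-y v≡y
    ... | no v≢y  | inj₁ v∈M = in-M v≢y v∈M
    ... | no v≢y  | inj₂ v∈y = ⊥-elim (v≢y (x∈⁅y⁆⇒x≡y y v∈y))

    y-meets-y : Meet y y
    y-meets-y = y , y∈ , y∈
      where
      y∈ : d y y ≤ ρ y
      y∈ = subst (_≤ ρ y) (sym (d-self y)) z≤n

    -- D(y, e(y) − R) meets D(w, R): walk from y towards w
    y-meets-M : (w : V G) → w ≢ y → w ∈ₛ M → Meet y w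
    y-meets-M w w≢y w∈M rewrite ρ-y | ρ-M w w≢y
      with geodesic-split y w (E y ∸ R) R
             (≤-trans (ecc-upper y w w∈M) (≤-trans (m≤n+m∸n (E y) R) (≤-reflexive (+-comm R _))))
    ... | z , yz , zw = z , yz , subst (_≤ R) (d-sym z w) zw

    -- two disks D(v, R), D(w, R) with v, w ∈ M meet in a centre
    M-meets-M : (v w : V G) → v ≢ y → w ≢ y → v ∈ₛ M → w ∈ₛ M → Meet v w
    M-meets-M v w v≢y w≢y v∈M w∈M rewrite ρ-M v v≢y | ρ-M w w≢y
      with centre-exists pos
    ... | c , Ec≤R = c , reaches v v∈M , reaches w w∈M
      where
      reaches : (u : V G) → u ∈ₛ M → d u c ≤ R
      reaches u u∈M = ≤-trans (≤-reflexive (d-sym u c)) (≤-trans (ecc-upper c u u∈M) Ec≤R)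

    pairwise : ∀ v w → v ∈ₛ S → w ∈ₛ S → Meet v w
    pairwise v w v∈S w∈S with kind v v∈S | kind w w∈S
    ... | is-y refl     | is-y refl     = y-meets-y
    ... | is-y refl     | in-M w≢y w∈M  = y-meets-M w w≢y w∈M
    ... | in-M v≢y v∈M  | is-y refl     = meet-sym (y-meets-M v v≢y v∈M)
    ... | in-M v≢y v∈M  | in-M w≢y w∈M  = M-meets-M v w v≢y w≢y v∈M w∈M

    enlarged-centre : (α : ℕ) (z : V G) → (∀ v → v ∈ₛ S → InDisk G d v (ρ v + α) z) →
      InCenter G d M α z
    enlarged-centre α z inDisks = ecc-least z (R + α) λ u u∈M →
      subst (_≤ R + α) (d-sym u z) (bound u u∈M (inDisks u (x∈p∪q⁺ (inj₁ u∈M))))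
      where
      ρ≤R : (u : V G) → u ∈ₛ M → ρ u ≤ R
      ρ≤R u u∈M with u ≟ y
      ... | yes refl = m≤n+o⇒m∸n≤o (E u) R (ecc-member pos u u∈M)
      ... | no _     = ≤-refl
      bound : (u : V G) → u ∈ₛ M → d u z ≤ ρ u + α → d u z ≤ R + α
      bound u u∈M uz = ≤-trans uz (+-monoˡ-≤ α (ρ≤R u u∈M))

  helly-centre : (α : ℕ) → WeaklyHelly G d α → 0 < n → (y : V G) →
    ∃[ z ] (InCenter G d M α z × d y z ≤ (E y ∸ R) + α)
  helly-centre α helly pos y =
    let z , inDisks = helly S ρ pairwise
    in z , enlarged-centre α z inDisks ,
       subst (λ r → d y z ≤ r + α) ρ-y (inDisks y (x∈p∪q⁺ (inj₂ (x∈⁅x⁆ y))))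
    where open HellyFamily pos y

budget : (e r α w : ℕ) → r ≤ e → e + w ≤ (r + α) + ((e ∸ r) + α) → w ≤ 2 * α
budget e r α w r≤e bound = +-cancelˡ-≤ e w (2 * α) (begin
    e + w                   ≤⟨ bound ⟩
    (r + α) + ((e ∸ r) + α) ≡⟨ regroup r α (e ∸ r) ⟩
    (r + (e ∸ r)) + 2 * α   ≡⟨ cong (_+ 2 * α) (m+[n∸m]≡n r≤e) ⟩
    e + 2 * α               ∎)
  where
  open ≤-Reasoning
  regroup : ∀ r α t → (r + α) + (t + α) ≡ (r + t) + 2 * α
  regroup = solve-∀

theorem8 : (G : Graph) (d : V G → V G → ℕ) (α : ℕ) (M : Subset (Graph.n G))
    → Connected G → IsDistance G d → WeaklyHelly G d α
    → (y x : V G)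
    → ¬ InCenter G d M α y
    → InCenter G d M α x
    → (∀ z → InCenter G d M α z → d y x ≤ d y z)
    → (P : Walk G y x) → len G P ≡ d y x
    → 2 * upCount G d M P + horCount G d M P ≤ 2 * α
theorem8 G d α M (pos , _) isD helly y x y∉C x∈C closest P |P|≡d =
  budget (E y) R α _ R≤Ey (begin
    E y + (2 * upCount G d M P + horCount G d M P) ≤⟨ walk-weight P ⟩
    E x + len G P                                  ≤⟨ +-mono-≤ x∈C |P|≤ ⟩
    (R + α) + ((E y ∸ R) + α)                      ∎)
  where
  open Eccentricity G d isD M
  open ≤-Reasoning
  -- y lies outside the α-centre, so e(y) > R + α
  R≤Ey : R ≤ E y
  R≤Ey = ≤-trans (m≤m+n R α) (<⇒≤ (≰⇒> y∉C))
  -- x is at least as close to y as the centre vertex z given by weak Helly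
  |P|≤ : len G P ≤ (E y ∸ R) + α
  |P|≤ = let z , z∈C , yz≤ = helly-centre α helly pos y
         in ≤-trans (≤-reflexive |P|≡d) (≤-trans (closest z z∈C) yz≤)
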